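{- Let $\Theta:\Sigma\to\Pi$ be the $\mathbb{Z}$-linear map defined by $\Theta(F_\alpha)=\theta_{\Lambda(\alpha)}$ for every composition $\alpha$. Then the nonzero differences $F_\alpha-F_{\Lambda(\alpha)}$ (over all compositions $\alpha$) form a basis of the kernel of $\Theta$.
   Context: A composition $\alpha=[\alpha_1,\ldots,\alpha_k]$ of $n$ ($\alpha\vDash n$) is an ordered list of positive integers summing to $n$; $k(\alpha)=k$; $I(\alpha)=\{\alpha_1,\alpha_1+\alpha_2,\ldots,\alpha_1+\cdots+\alpha_{k-1}\}\subset[n-1]$; $\alpha\preccurlyeq\beta$ ($\alpha$ refines $\beta$) means $I(\beta)\subset I(\alpha)$; $A+1=\{a+1:a\in A\}$. $M_\alpha=\sum_{i_1<\cdots<i_k}x_{i_1}^{\alpha_1}\cdots x_{i_k}^{\alpha_k}$, $M_0=1$; $\Sigma$ is the $\mathbb{Z}$-span of all $M_\alpha$ (the quasi-symmetric functions). $F_\alpha=\sum_{\alpha\preccurlyeq\beta}M_\beta$ (fundamental quasi-symmetric functions; they form a $\mathbb{Z}$-basis of $\Sigma$). For $\alpha\vDash n$, $\theta_\alpha=\sum_{\beta\vDash n,\ I(\alpha)\subset I(\beta)\cup(I(\beta)+1)}2^{k(\beta)}M_\beta$, $\theta_0=1$. A peak function is $\theta_\alpha$ with every component of $\alpha$ except possibly the last greater than $1$; $\Pi$ is the $\mathbb{Z}$-span of the peak functions. $\Lambda(\alpha)$ is the composition obtained from $\alpha$ by adding together each maximal block of adjacent components $\alpha_i,\alpha_{i+1},\ldots,\alpha_{i+j}$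 with $\alpha_{i+l}=1$ for $l=0,\ldots,j-1$ and either $\alpha_{i+j}\ne 1$ or $i+j=k$ (i.e., each component $>1$ absorbs the run of $1$'s immediately preceding it, and a final run of $1$'s is merged into one component). For example $\Lambda(31125111)=3453$. -}

module Defs where

open import Data.Nat as ℕ using (s≤s; z≤n; ℕ; zero; suc; _+_; _^_; _≤_; _<_; _≡ᵇ_)
open import Data.Nat.Properties using (≤-trans; m≤n+m)
open import Data.Integer as ℤ using (ℤ; +_; -_)
open import Data.Bool using (Bool; true; false; _∧_; _∨_; if_then_else_)
open import Data.List using (List; []; _∷_; map; length; _++_; foldr)
open import Data.Product using (_×_; _,_; proj₁; proj₂)
open import Relation.Binary.PropositionalEquality using (_≡_)
open import Relation.Nullary using (¬_)

record Pos : Set where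
  constructor ⟨_⟩
  field
    val  : ℕ
    .pos : 1 ≤ val
open Pos public

Composition : Set
Composition = List Pos

∣_∣ᶜ : Composition → ℕ
∣ [] ∣ᶜ = 0
∣ a ∷ α ∣ᶜ = val a + ∣ α ∣ᶜ

k : Composition → ℕ
k = length

-- I(α) = {α₁, α₁+α₂, …, α₁+⋯+α_{k-1}} as a list
I : Composition → List ℕ
I [] = []
I (a ∷ []) = []
I (a ∷ b ∷ α) = val a ∷ map (λ x → val a + x) (I (b ∷ α))

_∈ᵇ_ : ℕ → List ℕ → Bool
x ∈ᵇ [] = false
x ∈ᵇ (y ∷ ys) = (x ≡ᵇ y) ∨ (x ∈ᵇ ys)

_⊆ᵇ_ : List ℕ → List ℕ → Bool
[] ⊆ᵇ ys = true
(x ∷ xs) ⊆ᵇ ys = (x ∈ᵇ ys) ∧ (xs ⊆ᵇ ys)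

_+1 : List ℕ → List ℕ
A +1 = map suc A

_==ᶜ_ : Composition → Composition → Bool
[] ==ᶜ [] = true
[] ==ᶜ (_ ∷ _) = false
(_ ∷ _) ==ᶜ [] = false
(a ∷ α) ==ᶜ (b ∷ β) = (val a ≡ᵇ val b) ∧ (α ==ᶜ β)

-- Λ(α): each part > 1 absorbs the run of 1's immediately preceding it,
-- a final run of 1's is merged into one part.  The first argument of
-- Λ-go counts the pending run of 1's.
Λ-go : ℕ → Composition → Composition
Λ-go zero [] = []
Λ-go (suc m) [] = ⟨ suc m ⟩ (s≤s z≤n) ∷ []
Λ-go m (⟨ v ⟩ p ∷ α) with v ≡ᵇ 1
... | true  = Λ-go (suc m) α
... | false = ⟨ m + v ⟩ (≤-trans p (m≤n+m v m)) ∷ Λ-go 0 α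

Λ : Composition → Composition
Λ = Λ-go 0

-- An element of Σ, written in the fundamental basis: the list
-- [(c₁,α₁),…,(c_r,α_r)] stands for  c₁ F_{α₁} + ⋯ + c_r F_{α_r}.
ΣF : Set
ΣF = List (ℤ × Composition)

coeffF : ΣF → Composition → ℤ
coeffF f β = foldr (λ p acc → (if proj₂ p ==ᶜ β then proj₁ p else + 0) ℤ.+ acc) (+ 0) f

-- coefficient of M_β in θ_γ :
-- θ_γ = Σ_{β ⊨ |γ|, I(γ) ⊆ I(β) ∪ (I(β)+1)} 2^{k(β)} M_β
θcoeff : Composition → Composition → ℤ
θcoeff γ β =
  if (∣ β ∣ᶜ ≡ᵇ ∣ γ ∣ᶜ) ∧ (I γ ⊆ᵇ (I β ++ (I β +1)))
  then + (2 ^ k β) else + 0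

-- Θ(f), given by its coefficients in the monomial basis:
-- Θ(Σ c F_α) = Σ c θ_{Λ(α)}; (Θ f) β is the coefficient of M_β.
Θ : ΣF → Composition → ℤ
Θ f β = foldr (λ p acc → proj₁ p ℤ.* θcoeff (Λ (proj₂ p)) β ℤ.+ acc) (+ 0) f

InKerΘ : ΣF → Set
InKerΘ f = ∀ β → Θ f β ≡ + 0

IsZero : ΣF → Set
IsZero f = ∀ β → coeffF f β ≡ + 0

_≈Σ_ : ΣF → ΣF → Set
f ≈Σ g = ∀ β → coeffF f β ≡ coeffF g β

diff : Composition → ΣF
diff α = (+ 1 , α) ∷ (- (+ 1) , Λ α) ∷ []

combDiff : List (ℤ × Composition) → ΣF
combDiff [] = []
combDiff ((c , α) ∷ L) = (c , α) ∷ (- c , Λ α) ∷ combDiff L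

NonzeroDiff : Composition → Set
NonzeroDiff α = ¬ IsZero (diff α)

{-# OPTIONS --safe #-}
-- Λ sends every composition to a peak composition and fixes peak compositions, so Λ is
-- idempotent; hence Θ(F_α − F_{Λ(α)}) = θ_{Λ(α)} − θ_{Λ(Λ(α))} = 0, and F_α − F_{Λ(α)} ≠ 0
-- exactly when α is not fixed by Λ.  A non-fixed α never lies in the image of Λ, so the
-- coefficient of F_α in Σ c_α (F_α − F_{Λ(α)}) is c_α: the differences are independent.
-- Conversely f = Σ c_α F_α equals Σ_{Λ(α) ≠ α} c_α (F_α − F_{Λ(α)}) + Σ c_α F_{Λ(α)}, and
-- Θ f = 0 forces the second sum to vanish because the peak functions θ_γ (γ peak) are
-- independent: θ_γ has M_γ-coefficient 2^{k(γ)}, while the M_γ-coefficient of θ_{γ'} for a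
-- peak γ' ≠ γ is nonzero only if Φ γ' < Φ γ for a binary potential Φ (triangularity).
module Submission where

open import Defs
open import Data.Empty using (⊥-elim)
open import Data.Bool using (true; false; if_then_else_; _∧_)
open import Data.Bool.Properties using (if-float)
open import Data.Integer using (ℤ; +_; _+_; _*_; -_)
import Data.Integer.Properties as ℤ
open import Data.Integer.Tactic.RingSolver using (solve-∀)
open import Data.List using (List; []; _∷_; _++_; map; filter)
open import Data.List.Membership.Propositional using (_∈_; _∉_)
open import Data.List.Membership.Propositional.Properties using (∈-map⁺; ∈-map⁻; ∈-++⁺ˡ; ∈-++⁺ʳ; ∈-++⁻)
open import Data.List.Relation.Binary.Subset.Propositional using (_⊆_)
open import Data.List.Relation.Binary.Subset.Propositional.Properties using (∈-∷⁺ʳ)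
open import Data.List.Relation.Unary.All using (All; []; _∷_; lookup; tabulate)
import Data.List.Relation.Unary.All as All
open import Data.List.Relation.Unary.All.Properties using (All¬⇒¬Any; all-filter)
open import Data.List.Relation.Unary.AllPairs using (_∷_)
open import Data.List.Relation.Unary.Any using (here; there; fromSum; toSum)
open import Data.List.Relation.Unary.Unique.Propositional using (Unique)
open import Data.Nat as ℕ using (ℕ; zero; suc; s≤s; z≤n; _≤_; _<_; _^_; _≡ᵇ_)
open import Data.Nat.Induction using (<-wellFounded)
import Data.Nat.Properties as ℕ
open import Data.Product using (_×_; _,_; proj₁; proj₂; ∃-syntax; map₂; uncurry)
open import Data.Sum using (_⊎_; inj₁; inj₂; [_,_]′)
import Data.Sum as Sum
open import Function using (_∘_; id)
open import Induction.WellFounded using (Acc; acc)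
open import Relation.Binary.Definitions using (DecidableEquality)
open import Relation.Binary.PropositionalEquality using (_≡_; _≢_; refl; sym; trans; cong; cong₂; module ≡-Reasoning)
open import Relation.Nullary using (yes; no; _because_; ¬?; contradiction)
open import Relation.Nullary.Reflects using (Reflects; ofʸ; ofⁿ; fromEquivalence; _×-reflects_; _⊎-reflects_; det)

open ≡-Reasoning

Pos-≡ : ∀ {a b : Pos} → val a ≡ val b → a ≡ b
Pos-≡ refl = refl

positive : ∀ a → 1 ≤ val a
positive (⟨ zero ⟩ ())
positive (⟨ suc _ ⟩ _) = s≤s z≤n

map-reflects : ∀ {A B : Set} {b} → (A → B) → (B → A) → Reflects A b → Reflects B b
map-reflects f g (ofʸ a)  = ofʸ (f a)
map-reflects f g (ofⁿ ¬a) = ofⁿ (¬a ∘ g)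

≡ᵇ-reflects : ∀ m n → Reflects (m ≡ n) (m ≡ᵇ n)
≡ᵇ-reflects m n = fromEquivalence (ℕ.≡ᵇ⇒≡ m n) (ℕ.≡⇒≡ᵇ m n)

∈ᵇ-reflects : ∀ x ys → Reflects (x ∈ ys) (x ∈ᵇ ys)
∈ᵇ-reflects x []       = ofⁿ λ ()
∈ᵇ-reflects x (y ∷ ys) = map-reflects fromSum toSum (≡ᵇ-reflects x y ⊎-reflects ∈ᵇ-reflects x ys)

⊆ᵇ-reflects : ∀ xs ys → Reflects (xs ⊆ ys) (xs ⊆ᵇ ys)
⊆ᵇ-reflects []       ys = ofʸ λ ()
⊆ᵇ-reflects (x ∷ xs) ys =
  map-reflects (uncurry ∈-∷⁺ʳ) (λ x∷xs⊆ys → x∷xs⊆ys (here refl) , x∷xs⊆ys ∘ there)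
    (∈ᵇ-reflects x ys ×-reflects ⊆ᵇ-reflects xs ys)

==ᶜ-reflects : ∀ α β → Reflects (α ≡ β) (α ==ᶜ β)
==ᶜ-reflects []      []      = ofʸ refl
==ᶜ-reflects []      (_ ∷ _) = ofⁿ λ ()
==ᶜ-reflects (_ ∷ _) []      = ofⁿ λ ()
==ᶜ-reflects (a ∷ α) (b ∷ β) =
  map-reflects (uncurry (cong₂ _∷_ ∘ Pos-≡)) (λ { refl → refl , refl })
    (≡ᵇ-reflects (val a) (val b) ×-reflects ==ᶜ-reflects α β)

_≟ᶜ_ : DecidableEquality Composition
α ≟ᶜ β = (α ==ᶜ β) because ==ᶜ-reflects α β

open import Data.List.Membership.DecPropositional _≟ᶜ_ using (_∈?_)

coeffF-∷-≡ : ∀ c α f → coeffF ((c , α) ∷ f) α ≡ c + coeffF f α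
coeffF-∷-≡ c α f rewrite det (==ᶜ-reflects α α) (ofʸ refl) = refl

coeffF-∷-≢ : ∀ {c α β} f → α ≢ β → coeffF ((c , α) ∷ f) β ≡ coeffF f β
coeffF-∷-≢ {α = α} {β} f α≢β rewrite det (==ᶜ-reflects α β) (ofⁿ α≢β) = ℤ.+-identityˡ _

coeffF-∷-cong : ∀ {f g β} p → coeffF f β ≡ coeffF g β → coeffF (p ∷ f) β ≡ coeffF (p ∷ g) β
coeffF-∷-cong {β = β} (c , α) = cong (_+_ (if α ==ᶜ β then c else + 0))

coeffF-∉ : ∀ {α} f → α ∉ map proj₂ f → coeffF f α ≡ + 0
coeffF-∉ []             α∉ = refl
coeffF-∉ ((c , α') ∷ f) α∉ = trans (coeffF-∷-≢ f (α∉ ∘ here ∘ sym)) (coeffF-∉ f (α∉ ∘ there))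

coeffF≢0⇒∈ : ∀ {α} f → coeffF f α ≢ + 0 → α ∈ map proj₂ f
coeffF≢0⇒∈ {α} f coeff≢0 with α ∈? map proj₂ f
... | yes α∈ = α∈
... | no  α∉ = contradiction (coeffF-∉ f α∉) coeff≢0

coeffF-unique-∈ : ∀ {c α} f → Unique (map proj₂ f) → (c , α) ∈ f → coeffF f α ≡ c
coeffF-unique-∈ {c} {α} (_ ∷ f) (α∉ ∷ _) (here refl) = begin
  coeffF ((c , α) ∷ f) α ≡⟨ coeffF-∷-≡ c α f ⟩
  c + coeffF f α         ≡⟨ cong (_+_ c) (coeffF-∉ f (All¬⇒¬Any α∉)) ⟩
  c + + 0                ≡⟨ ℤ.+-identityʳ c ⟩
  c                      ∎
coeffF-unique-∈ ((_ , α') ∷ f) (α'∉ ∷ unique) (there ∈f) =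
  trans (coeffF-∷-≢ f (lookup α'∉ (∈-map⁺ proj₂ ∈f))) (coeffF-unique-∈ f unique ∈f)

linExt : (Composition → ℤ) → ΣF → ℤ
linExt h []            = + 0
linExt h ((c , γ) ∷ g) = c * h γ + linExt h g

zeroAt : Composition → (Composition → ℤ) → Composition → ℤ
zeroAt γ h γ' = if γ' ==ᶜ γ then + 0 else h γ'

linExt-split : ∀ γ h g → linExt h g ≡ linExt (zeroAt γ h) g + coeffF g γ * h γ
linExt-split γ h []             = refl
linExt-split γ h ((c , γ') ∷ g) with γ' ==ᶜ γ | ==ᶜ-reflects γ' γ
... | true  | ofʸ refl rewrite linExt-split γ h g = at-γ c (h γ) _ (coeffF g γ)
  where
  at-γ : ∀ c x L C → c * x + (L + C * x) ≡ (c * + 0 + L) + (c + C) * x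
  at-γ = solve-∀
... | false | ofⁿ _    rewrite linExt-split γ h g = elsewhere (c * h γ') _ (coeffF g γ) (h γ)
  where
  elsewhere : ∀ t L C x → t + (L + C * x) ≡ (t + L) + (+ 0 + C) * x
  elsewhere = solve-∀

-- The induction runs over all h at once: the head's composition γ has its whole coefficient
-- collected by linExt-split, after which h may be replaced by zeroAt γ h on the rest.
linExt-vanishes : ∀ g h → (∀ γ → coeffF g γ * h γ ≡ + 0) → linExt h g ≡ + 0
linExt-vanishes []            h vanish = refl
linExt-vanishes ((c , γ) ∷ g) h vanish = begin
  c * h γ + linExt h g                                 ≡⟨ cong (_+_ (c * h γ)) (linExt-split γ h g) ⟩
  c * h γ + (linExt (zeroAt γ h) g + coeffF g γ * h γ) ≡⟨ regroup c (h γ) _ (coeffF g γ) ⟩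
  (c + coeffF g γ) * h γ + linExt (zeroAt γ h) g       ≡⟨ cong₂ _+_ at-γ (linExt-vanishes g (zeroAt γ h) elsewhere) ⟩
  + 0                                                  ∎
  where
  regroup : ∀ c x L C → c * x + (L + C * x) ≡ (c + C) * x + L
  regroup = solve-∀
  at-γ : (c + coeffF g γ) * h γ ≡ + 0
  at-γ = trans (cong (_* h γ) (sym (coeffF-∷-≡ c γ g))) (vanish γ)
  elsewhere : ∀ γ' → coeffF g γ' * zeroAt γ h γ' ≡ + 0
  elsewhere γ' with γ' ==ᶜ γ | ==ᶜ-reflects γ' γ
  ... | true  | _        = ℤ.*-zeroʳ (coeffF g γ')
  ... | false | ofⁿ γ'≢γ = trans (cong (_* h γ') (sym (coeffF-∷-≢ g (γ'≢γ ∘ sym)))) (vanish γ')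

data Peak : Composition → Set where
  []  : Peak []
  [_] : ∀ a → Peak (a ∷ [])
  _∷_ : ∀ {a b β} → 2 ≤ val a → Peak (b ∷ β) → Peak (a ∷ b ∷ β)

peak-cons : ∀ {a γ} → 2 ≤ val a → Peak γ → Peak (a ∷ γ)
peak-cons {a} 2≤a []           = [ a ]
peak-cons     2≤a [ b ]        = 2≤a ∷ [ b ]
peak-cons     2≤a (2≤b ∷ peak) = 2≤a ∷ 2≤b ∷ peak

absorbing-part≥2 : ∀ m a → val a ≢ 1 → 2 ≤ m ℕ.+ val a
absorbing-part≥2 m a a≢1 = ℕ.≤-trans (ℕ.≤∧≢⇒< (positive a) (a≢1 ∘ sym)) (ℕ.m≤n+m (val a) m)

-- Λ-go m (a ∷ α) only reduces once m is a constructor, hence the split on m.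
Λ-go-peak : ∀ m α → Peak (Λ-go m α)
Λ-go-peak zero    []            = []
Λ-go-peak (suc m) []            = [ _ ]
Λ-go-peak zero    (⟨ v ⟩ p ∷ α) with v ≡ᵇ 1 | ≡ᵇ-reflects v 1
... | true  | _        = Λ-go-peak 1 α
... | false | ofⁿ v≢1 = peak-cons (absorbing-part≥2 0 (⟨ v ⟩ p) v≢1) (Λ-go-peak 0 α)
Λ-go-peak (suc m) (⟨ v ⟩ p ∷ α) with v ≡ᵇ 1 | ≡ᵇ-reflects v 1
... | true  | _        = Λ-go-peak (suc (suc m)) α
... | false | ofⁿ v≢1 = peak-cons (absorbing-part≥2 (suc m) (⟨ v ⟩ p) v≢1) (Λ-go-peak 0 α)

Λ-peak : ∀ α → Peak (Λ α)
Λ-peak = Λ-go-peak 0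

Λ-fixes-peak : ∀ {γ} → Peak γ → Λ γ ≡ γ
Λ-fixes-peak [] = refl
Λ-fixes-peak [ ⟨ v ⟩ p ] with v ≡ᵇ 1 | ≡ᵇ-reflects v 1
... | true  | ofʸ refl = refl
... | false | _        = refl
Λ-fixes-peak (_∷_ {⟨ v ⟩ p} 2≤v peak) with v ≡ᵇ 1 | ≡ᵇ-reflects v 1
... | true  | ofʸ refl = contradiction 2≤v λ { (s≤s ()) }
... | false | _        = cong (⟨ v ⟩ p ∷_) (Λ-fixes-peak peak)

Λ-idempotent : ∀ α → Λ (Λ α) ≡ Λ α
Λ-idempotent α = Λ-fixes-peak (Λ-peak α)

nonfixed∉Λ-image : ∀ {α} α' → Λ α ≢ α → Λ α' ≢ α
nonfixed∉Λ-image α' Λα≢α refl = Λα≢α (Λ-idempotent α')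

coeffF-combDiff-nonfixed : ∀ {α} L → Λ α ≢ α → coeffF (combDiff L) α ≡ coeffF L α
coeffF-combDiff-nonfixed []             Λα≢α = refl
coeffF-combDiff-nonfixed ((c , α') ∷ L) Λα≢α =
  coeffF-∷-cong {f = (- c , Λ α') ∷ combDiff L} {g = L} (c , α')
    (trans (coeffF-∷-≢ (combDiff L) (nonfixed∉Λ-image α' Λα≢α)) (coeffF-combDiff-nonfixed L Λα≢α))

nonzeroDiff⇒nonfixed : ∀ {α} → NonzeroDiff α → Λ α ≢ α
nonzeroDiff⇒nonfixed {α} diff≢0 Λα≡α = diff≢0 cancels
  where
  cancels : ∀ β → coeffF (diff α) β ≡ + 0
  cancels β rewrite Λα≡α with α ==ᶜ β
  ... | true  = refl
  ... | false = refl

nonfixed⇒nonzeroDiff : ∀ {α} → Λ α ≢ α → NonzeroDiff α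
nonfixed⇒nonzeroDiff {α} Λα≢α diff≈0 = contradiction coeff-α λ ()
  where
  coeff-α : + 1 ≡ + 0
  coeff-α = begin
    + 1                       ≡⟨ sym (coeffF-∷-≡ (+ 1) α []) ⟩
    coeffF ((+ 1 , α) ∷ []) α ≡⟨ sym (coeffF-combDiff-nonfixed ((+ 1 , α) ∷ []) Λα≢α) ⟩
    coeffF (diff α) α         ≡⟨ diff≈0 α ⟩
    + 0                       ∎

diff∈kerΘ : ∀ α → InKerΘ (diff α)
diff∈kerΘ α β rewrite Λ-idempotent α = cancel (θcoeff (Λ α) β)
  where
  cancel : ∀ x → + 1 * x + (- + 1 * x + + 0) ≡ + 0
  cancel = solve-∀

combDiff-independent : ∀ (L : List (ℤ × Composition))
  → All (λ p → NonzeroDiff (proj₂ p)) L → Unique (map proj₂ L)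
  → IsZero (combDiff L) → All (λ p → proj₁ p ≡ + 0) L
combDiff-independent L nonzero unique L≈0 = tabulate λ { {c , α} ∈L → begin
  c                     ≡⟨ sym (coeffF-unique-∈ L unique ∈L) ⟩
  coeffF L α            ≡⟨ sym (coeffF-combDiff-nonfixed L (nonzeroDiff⇒nonfixed (lookup nonzero ∈L))) ⟩
  coeffF (combDiff L) α ≡⟨ L≈0 α ⟩
  + 0                   ∎ }

-- Φ γ = Σ_{s ∈ I(γ)} 2^{|γ| − s}: the set I(γ) read as a binary number whose most
-- significant digit is its least element.
Φ : Composition → ℕ
Φ []          = 0
Φ (a ∷ [])    = 0
Φ (a ∷ b ∷ β) = 2 ^ ∣ b ∷ β ∣ᶜ ℕ.+ Φ (b ∷ β)

∣∣ᶜ-cons>0 : ∀ a γ → 0 < ∣ a ∷ γ ∣ᶜ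
∣∣ᶜ-cons>0 a γ = ℕ.≤-trans (positive a) (ℕ.m≤m+n (val a) ∣ γ ∣ᶜ)

Φ-cons< : ∀ a γ → Φ (a ∷ γ) < 2 ^ suc ∣ γ ∣ᶜ
Φ-cons< a []      = ℕ.m^n>0 2 1
Φ-cons< a (b ∷ β) = ℕ.+-monoʳ-< (2 ^ ∣ b ∷ β ∣ᶜ) (ℕ.≤-trans Φ-tail< (ℕ.m≤m+n _ 0))
  where
  Φ-tail< : Φ (b ∷ β) < 2 ^ ∣ b ∷ β ∣ᶜ
  Φ-tail< = ℕ.<-≤-trans (Φ-cons< b β) (ℕ.^-monoʳ-≤ 2 (ℕ.+-monoˡ-≤ ∣ β ∣ᶜ (positive b)))

I-head≤ : ∀ a γ {x} → x ∈ I (a ∷ γ) → val a ≤ x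
I-head≤ a (b ∷ β) (here refl) = ℕ.≤-refl
I-head≤ a (b ∷ β) (there x∈)  with ∈-map⁻ (ℕ._+_ (val a)) x∈
... | y , _ , refl = ℕ.m≤m+n (val a) y

Peak-I≥2 : ∀ {γ x} → Peak γ → x ∈ I γ → 2 ≤ x
Peak-I≥2 {a ∷ γ} (2≤a ∷ _) x∈ = ℕ.≤-trans 2≤a (I-head≤ a γ x∈)

I∪I+1-head≤ : ∀ a γ {x} → x ∈ I (a ∷ γ) ++ (I (a ∷ γ) +1) → val a ≤ x
I∪I+1-head≤ a γ x∈ with ∈-++⁻ (I (a ∷ γ)) x∈
... | inj₁ x∈I   = I-head≤ a γ x∈I
... | inj₂ x∈I+1 with ∈-map⁻ suc x∈I+1
...   | y , y∈I , refl = ℕ.m≤n⇒m≤1+n (I-head≤ a γ y∈I)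

unshift-∪+1 : ∀ m A {x} → 2 ≤ x
  → m ℕ.+ x ∈ (m ∷ map (ℕ._+_ m) A) ++ ((m ∷ map (ℕ._+_ m) A) +1) → x ∈ A ++ (A +1)
unshift-∪+1 m A (s≤s (s≤s _)) m+x∈ with ∈-++⁻ (m ∷ map (ℕ._+_ m) A) m+x∈
... | inj₁ (here m+x≡m) = contradiction (ℕ.+-cancelˡ-≡ m _ 0 (trans m+x≡m (sym (ℕ.+-identityʳ m)))) λ ()
... | inj₁ (there m+x∈) with ∈-map⁻ (ℕ._+_ m) m+x∈
...   | y , y∈A , m+x≡m+y rewrite ℕ.+-cancelˡ-≡ m _ _ m+x≡m+y = ∈-++⁺ˡ y∈A
unshift-∪+1 m A (s≤s (s≤s _)) m+x∈ | inj₂ m+x∈+1 with ∈-map⁻ suc m+x∈+1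
... | _ , here refl , m+x≡1+m = contradiction (ℕ.+-cancelˡ-≡ m _ 1 (trans m+x≡1+m (ℕ.+-comm 1 m))) λ ()
... | _ , there y∈ , m+x≡1+z with ∈-map⁻ (ℕ._+_ m) y∈
...   | y , y∈A , refl rewrite ℕ.+-cancelˡ-≡ m _ (suc y) (trans m+x≡1+z (sym (ℕ.+-suc m y))) =
  ∈-++⁺ʳ A (∈-map⁺ suc y∈A)

-- The first part a' of γ' lies in I(γ) ∪ (I(γ)+1), so a ≤ a'.  If a < a', the tail of γ'
-- is shorter and Φ γ' < 2^{|γ| − a} ≤ Φ γ.  If a = a', recurse on the tails: the cover
-- descends to them because the points of I of a peak tail are ≥ 2, so a + x ∉ {a, a + 1}.
Φ-triangular : ∀ {γ' γ} → Peak γ' → ∣ γ' ∣ᶜ ≡ ∣ γ ∣ᶜ → I γ' ⊆ I γ ++ (I γ +1) → γ' ≡ γ ⊎ Φ γ' < Φ γ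
Φ-triangular {[]}     {[]}    _ _    _ = inj₁ refl
Φ-triangular {[]}     {a ∷ γ} _ size _ = contradiction size (ℕ.<⇒≢ (∣∣ᶜ-cons>0 a γ))
Φ-triangular {a' ∷ γ'} {[]}   _ size _ = contradiction (sym size) (ℕ.<⇒≢ (∣∣ᶜ-cons>0 a' γ'))
Φ-triangular {a' ∷ []} {a ∷ []}    _ size _ = inj₁ (cong (_∷ []) (Pos-≡ (ℕ.+-cancelʳ-≡ 0 _ _ size)))
Φ-triangular {a' ∷ []} {a ∷ b ∷ β} _ _    _ = inj₂ (ℕ.<-≤-trans (ℕ.m^n>0 2 ∣ b ∷ β ∣ᶜ) (ℕ.m≤m+n _ _))
Φ-triangular {a' ∷ b' ∷ β'} {a ∷ []} _ _ cover with cover (here refl)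
... | ()
Φ-triangular {a' ∷ b' ∷ β'} {a ∷ b ∷ β} (_ ∷ peak) size cover
  with ℕ.m≤n⇒m<n∨m≡n (I∪I+1-head≤ a (b ∷ β) (cover (here refl)))
... | inj₁ a<a' = inj₂ (ℕ.<-≤-trans (Φ-cons< a' (b' ∷ β'))
                         (ℕ.≤-trans (ℕ.^-monoʳ-≤ 2 tail-shorter) (ℕ.m≤m+n _ _)))
  where
  tail-shorter : ∣ b' ∷ β' ∣ᶜ < ∣ b ∷ β ∣ᶜ
  tail-shorter = ℕ.+-cancelˡ-< (val a) _ _ (ℕ.<-≤-trans (ℕ.+-monoˡ-< _ a<a') (ℕ.≤-reflexive size))
... | inj₂ a≡a' with Pos-≡ {a} {a'} a≡a'
...   | refl = Sum.map (cong (a ∷_)) (ℕ.+-mono-≤-< (ℕ.≤-reflexive (cong (2 ^_) tail-size)))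
                 (Φ-triangular peak tail-size tail-cover)
  where
  tail-size : ∣ b' ∷ β' ∣ᶜ ≡ ∣ b ∷ β ∣ᶜ
  tail-size = ℕ.+-cancelˡ-≡ (val a) _ _ size
  tail-cover : I (b' ∷ β') ⊆ I (b ∷ β) ++ (I (b ∷ β) +1)
  tail-cover x∈ = unshift-∪+1 (val a) (I (b ∷ β)) (Peak-I≥2 peak x∈)
                    (cover (there (∈-map⁺ (ℕ._+_ (val a)) x∈)))

θcoeff-support-reflects : ∀ γ β →
  Reflects (∣ β ∣ᶜ ≡ ∣ γ ∣ᶜ × I γ ⊆ I β ++ (I β +1)) ((∣ β ∣ᶜ ≡ᵇ ∣ γ ∣ᶜ) ∧ (I γ ⊆ᵇ (I β ++ (I β +1))))
θcoeff-support-reflects γ β = ≡ᵇ-reflects ∣ β ∣ᶜ ∣ γ ∣ᶜ ×-reflects ⊆ᵇ-reflects (I γ) (I β ++ (I β +1))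

θcoeff≢0⇒support : ∀ γ β → θcoeff γ β ≢ + 0 → ∣ β ∣ᶜ ≡ ∣ γ ∣ᶜ × I γ ⊆ I β ++ (I β +1)
θcoeff≢0⇒support γ β θ≢0 with (∣ β ∣ᶜ ≡ᵇ ∣ γ ∣ᶜ) ∧ (I γ ⊆ᵇ (I β ++ (I β +1))) | θcoeff-support-reflects γ β
... | true  | ofʸ support = support
... | false | _         = contradiction refl θ≢0

θcoeff-diagonal≢0 : ∀ γ → θcoeff γ γ ≢ + 0
θcoeff-diagonal≢0 γ with (∣ γ ∣ᶜ ≡ᵇ ∣ γ ∣ᶜ) ∧ (I γ ⊆ᵇ (I γ ++ (I γ +1))) | θcoeff-support-reflects γ γ
... | true  | _            = ℕ.<⇒≢ (ℕ.m^n>0 2 (k γ)) ∘ sym ∘ ℤ.+-injective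
... | false | ofⁿ ¬support = contradiction (refl , λ {x} → ∈-++⁺ˡ) ¬support

θcoeff-triangular : ∀ {γ' γ} → Peak γ' → θcoeff γ' γ ≢ + 0 → γ' ≡ γ ⊎ Φ γ' < Φ γ
θcoeff-triangular {γ'} {γ} peak θ≢0 =
  let size , cover = θcoeff≢0⇒support γ' γ θ≢0 in Φ-triangular peak (sym size) cover

peak-θ-independent : ∀ g → All Peak (map proj₂ g)
  → (∀ β → linExt (λ γ → θcoeff γ β) g ≡ + 0) → ∀ γ → coeffF g γ ≡ + 0
peak-θ-independent g peaks g↦0 γ = go γ (<-wellFounded (Φ γ))
  where
  go : ∀ γ → Acc _<_ (Φ γ) → coeffF g γ ≡ + 0
  go γ (acc below) = [ id , ⊥-elim ∘ θcoeff-diagonal≢0 γ ]′ (ℤ.i*j≡0⇒i≡0∨j≡0 (coeffF g γ) diagonal)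
    where
    θ : Composition → ℤ
    θ γ' = θcoeff γ' γ
    off-diagonal : ∀ γ' → coeffF g γ' * zeroAt γ θ γ' ≡ + 0
    off-diagonal γ' with γ' ==ᶜ γ | ==ᶜ-reflects γ' γ
    ... | true  | _        = ℤ.*-zeroʳ (coeffF g γ')
    ... | false | ofⁿ γ'≢γ with coeffF g γ' ℤ.≟ + 0 | θ γ' ℤ.≟ + 0
    ...   | yes c≡0 | _       = cong (_* θ γ') c≡0
    ...   | no  _   | yes θ≡0 = trans (cong (coeffF g γ' *_) θ≡0) (ℤ.*-zeroʳ (coeffF g γ'))
    ...   | no  c≢0 | no  θ≢0 with θcoeff-triangular (lookup peaks (coeffF≢0⇒∈ g c≢0)) θ≢0
    ...     | inj₁ γ'≡γ = contradiction γ'≡γ γ'≢γ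
    ...     | inj₂ Φ<   = contradiction (go γ' (below Φ<)) c≢0
    diagonal : coeffF g γ * θ γ ≡ + 0
    diagonal = begin
      coeffF g γ * θ γ                         ≡⟨ sym (ℤ.+-identityˡ _) ⟩
      + 0 + coeffF g γ * θ γ                   ≡⟨ cong (_+ coeffF g γ * θ γ) (sym (linExt-vanishes g _ off-diagonal)) ⟩
      linExt (zeroAt γ θ) g + coeffF g γ * θ γ ≡⟨ sym (linExt-split γ θ g) ⟩
      linExt θ g                               ≡⟨ g↦0 γ ⟩
      + 0                                      ∎

Λmap : ΣF → ΣF
Λmap = map (map₂ Λ)

Λmap-peak : ∀ f → All Peak (map proj₂ (Λmap f))
Λmap-peak []            = []
Λmap-peak ((c , α) ∷ f) = Λ-peak α ∷ Λmap-peak f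

Θ≡linExt-Λmap : ∀ f β → Θ f β ≡ linExt (λ γ → θcoeff γ β) (Λmap f)
Θ≡linExt-Λmap []            β = refl
Θ≡linExt-Λmap ((c , α) ∷ f) β = cong (_+_ (c * θcoeff (Λ α) β)) (Θ≡linExt-Λmap f β)

nonFixed : ΣF → ΣF
nonFixed = filter (λ p → ¬? (Λ (proj₂ p) ≟ᶜ proj₂ p))

coeffF-decompose : ∀ f β → coeffF f β ≡ coeffF (combDiff (nonFixed f)) β + coeffF (Λmap f) β
coeffF-decompose []            β = refl
coeffF-decompose ((c , α) ∷ f) β with Λ α ==ᶜ α | ==ᶜ-reflects (Λ α) α
... | true  | ofʸ Λα≡α rewrite Λα≡α | coeffF-decompose f β =
  exchange (if α ==ᶜ β then c else + 0) (coeffF (combDiff (nonFixed f)) β) (coeffF (Λmap f) β)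
  where
  exchange : ∀ x C G → x + (C + G) ≡ C + (x + G)
  exchange = solve-∀
... | false | ofⁿ _    rewrite coeffF-decompose f β | sym (if-float -_ (Λ α ==ᶜ β) {c} {+ 0}) =
  insert-cancelling (if α ==ᶜ β then c else + 0) (if Λ α ==ᶜ β then c else + 0)
                    (coeffF (combDiff (nonFixed f)) β) (coeffF (Λmap f) β)
  where
  insert-cancelling : ∀ x y C G → x + (C + G) ≡ (x + (- y + C)) + (y + G)
  insert-cancelling = solve-∀

kerΘ-spanned : ∀ (f : ΣF) → InKerΘ f
  → ∃[ L ] (All (λ p → NonzeroDiff (proj₂ p)) L × f ≈Σ combDiff L)
kerΘ-spanned f f∈kerΘ = nonFixed f , All.map nonfixed⇒nonzeroDiff (all-filter _ f) , decomposition
  where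
  Λmap≈0 : IsZero (Λmap f)
  Λmap≈0 = peak-θ-independent (Λmap f) (Λmap-peak f) λ β → trans (sym (Θ≡linExt-Λmap f β)) (f∈kerΘ β)
  decomposition : f ≈Σ combDiff (nonFixed f)
  decomposition β = let C = coeffF (combDiff (nonFixed f)) β in begin
    coeffF f β            ≡⟨ coeffF-decompose f β ⟩
    C + coeffF (Λmap f) β ≡⟨ cong (_+_ C) (Λmap≈0 β) ⟩
    C + + 0               ≡⟨ ℤ.+-identityʳ C ⟩
    C                     ∎

lemma2p3 :
    -- each nonzero difference F_α − F_{Λ(α)} lies in ker Θ
    (∀ α → NonzeroDiff α → InKerΘ (diff α))
    -- linear independence over ℤ of the nonzero differences
    × (∀ (L : List (ℤ × Composition))
         → All (λ p → NonzeroDiff (proj₂ p)) L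
         → Unique (map proj₂ L)
         → IsZero (combDiff L)
         → All (λ p → proj₁ p ≡ + 0) L)
    -- they span ker Θ over ℤ
    × (∀ (f : ΣF) → InKerΘ f
         → ∃[ L ] (All (λ p → NonzeroDiff (proj₂ p)) L × f ≈Σ combDiff L))
lemma2p3 = (λ α _ → diff∈kerΘ α) , combDiff-independent , kerΘ-spanned
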